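{- Fix a permutation $\pi$ of the nodes of $G=(V,E^+)$. Running the Sequential Truncated-Pivot algorithm with $\pi$ outputs the same clustering as running the Parallel Truncated-Pivot algorithm with $\pi$ (both as described in the context, with the same parameters $\varepsilon$, $c$).
   Context: $G=(V,E^+)$ is a simple undirected graph on $n$ nodes, $\deg(u)$ the degree of $u$ in $G$; $\pi:V\to\{1,\dots,n\}$ a bijection. Parallel Truncated-Pivot with permutation $\pi$: let $\tau_u=\frac{c}{\varepsilon}\cdot\frac{n\log n}{\deg(u)}$; $u$ is uninteresting if $\pi_u\ge\tau_u$, interesting otherwise; $G_{\mathrm{store}}$ is the subgraph induced by interesting nodes; $\mathcal{I}$ is the greedy maximal independent set of $G_{\mathrm{store}}$ in increasing order of $\pi$; nodes of $\mathcal{I}$ are pivots; each $u\in V\setminus\mathcal{I}$ joins the cluster of its smallest-$\pi$ pivot neighbor $v$ if $\pi_v<\tau_u$; other nodes form singleton clusters. Sequential Truncated-Pivot with permutation $\pi$: all nodes start active. For $i=1,\dots,n$: let $\ell_i=\frac{c}{\varepsilon}\cdot\frac{n\log n}{i}$ and $u$ the node with $\pi_u=i$; every active node $v$ with $\deg(v)\ge\ell_i$ becomes inactive and forms a singleton cluster; then if $u$ is active, create a pivot cluster of $u$ and its active neighbors, all of which become inactive. -}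

module Defs where

open import Data.Bool using (Bool; true; false; if_then_else_; not; _∧_; _∨_; T)
open import Data.Nat using (ℕ; zero; suc; _*_; _≤ᵇ_; _<ᵇ_)
open import Data.Fin using (Fin; toℕ; _≟_)
open import Data.Fin.Permutation using (Permutation′; _⟨$⟩ʳ_; _⟨$⟩ˡ_)
open import Data.List using (List; []; _∷_; map; foldl; length; filter)
open import Data.Bool.ListAction using (any)
open import Data.List.Base using (allFin)
open import Data.Maybe using (Maybe; just; nothing; fromMaybe; is-nothing)
open import Relation.Nullary.Decidable using (⌊_⌋)
open import Relation.Binary.PropositionalEquality using (_≡_)
open import Data.Empty using (⊥)

record Graph (n : ℕ) : Set where
  field
    adj   : Fin n → Fin n → Bool
    sym   : ∀ u v → adj u v ≡ adj v u
    irrefl : ∀ u → adj u u ≡ false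
open Graph public

module _ {n : ℕ} (G : Graph n) (π : Permutation′ n) (m : ℕ) where
  -- m is ⌈K⌉ where K = (c/ε)·n·log n: for a natural x,
  -- x ≥ K  iff  m ≤ x,  and  x < K  iff  x < m.

  eqᵇ : Fin n → Fin n → Bool
  eqᵇ u v = ⌊ u ≟ v ⌋

  deg : Fin n → ℕ
  deg u = length (filter (λ v → T? (adj G u v)) (allFin n))
    where
    open import Data.Bool.Properties using () renaming (T? to T?)

  rank : Fin n → ℕ
  rank u = suc (toℕ (π ⟨$⟩ʳ u))

  byRank : List (Fin n)
  byRank = map (π ⟨$⟩ˡ_) (allFin n)

  firstᵇ : (Fin n → Bool) → List (Fin n) → Maybe (Fin n)
  firstᵇ p [] = nothing
  firstᵇ p (x ∷ xs) = if p x then just x else firstᵇ p xs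

  -- Parallel Truncated-Pivot
  -- u uninteresting iff π_u ≥ τ_u = K / deg(u)  iff  π_u·deg(u) ≥ K
  interesting : Fin n → Bool
  interesting u = rank u * deg u <ᵇ m

  -- greedy MIS of G_store in increasing order of π
  misStep : (Fin n → Bool) → Fin n → (Fin n → Bool)
  misStep I u =
    if interesting u ∧ not (any (λ w → I w ∧ adj G u w) (allFin n))
    then (λ v → eqᵇ v u ∨ I v) else I

  pivotSet : Fin n → Bool
  pivotSet = foldl misStep (λ _ → false) byRank

  parLeader : Fin n → Fin n
  parLeader u with pivotSet u
  ... | true = u
  ... | false with firstᵇ (λ v → pivotSet v ∧ adj G u v) byRank
  ...   | nothing = u
  -- joins pivot v iff π_v < τ_u = K/deg(u)  iff  π_v·deg(u) < K
  ...   | just v = if rank v * deg u <ᵇ m then v else u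

  -- Sequential Truncated-Pivot
  -- state: nothing = active, just l = inactive, in the cluster labelled l
  State : Set
  State = Fin n → Maybe (Fin n)

  seqStep : State → Fin n → State
  seqStep s u = s₂
    where
    i : ℕ
    i = rank u
    -- active v with deg(v) ≥ ℓ_i = K/i  (iff i·deg(v) ≥ K) becomes singleton
    s₁ : State
    s₁ v = if is-nothing (s v) ∧ (m ≤ᵇ i * deg v) then just v else s v
    s₂ : State
    s₂ = if is-nothing (s₁ u)
         then (λ v → if is-nothing (s₁ v) ∧ (eqᵇ v u ∨ adj G u v) then just u else s₁ v)
         else s₁

  seqFinal : State
  seqFinal = foldl seqStep (λ _ → nothing) byRank

  -- every node is inactive at the end; the default u is never used
  seqLeader : Fin n → Fin n
  seqLeader u = fromMaybe u (seqFinal u)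

SameClustering : {n : ℕ} → (Fin n → Fin n) → (Fin n → Fin n) → Set
SameClustering {n} f g = ∀ (u v : Fin n) → (f u ≡ f v → g u ≡ g v) Data.Product.× (g u ≡ g v → f u ≡ f v)
  where import Data.Product

-- Both runs visit the nodes in increasing order of π, and the greedy pass makes v a pivot
-- iff v is interesting and has no pivot neighbour of smaller rank. By induction on k, once
-- the nodes of rank ≤ k have been visited the sequential state agrees with the parallel
-- clustering: every inactive node already carries its parallel label (and is no pivot
-- unless visited), and every active node has rank > k and no pivot neighbour of rank ≤ k.
-- At the step of u, u survives truncation exactly when it is a pivot. A node truncated at
-- this step has all its pivot neighbours at rank ≥ π_u, hence beyond its threshold, so it
-- is a singleton in the parallel run too; an active neighbour of the pivot u has u as its
-- pivot neighbour of smallest rank and joins it in both runs.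

module Submission where

open import Defs using (Graph; adj; SameClustering; seqLeader; parLeader)
import Defs as D
open import Data.Bool using (Bool; true; false; if_then_else_; not; _∧_; _∨_)
open import Data.Bool.Properties using (T-≡; ∧-conicalˡ; ∧-conicalʳ; ∧-zeroʳ; ∧-identityʳ; ¬-not; if-float)
open import Data.Bool.ListAction using (any)
open import Data.Fin using (Fin; toℕ; _≟_)
open import Data.Fin.Permutation using (Permutation′; _⟨$⟩ʳ_; _⟨$⟩ˡ_; inverseˡ; inverseʳ)
open import Data.Fin.Properties using (toℕ<n; toℕ-injective)
open import Data.List using (List; []; _∷_; foldl; foldr; tabulate; allFin)
open import Data.List.Properties using (map-tabulate; map-cong)
open import Data.Maybe using (Maybe; just; nothing; is-nothing)
open import Data.Nat using (ℕ; zero; suc; _*_; _≤_; _<_; _<ᵇ_; _≤ᵇ_; z<s; s≤s; s≤s⁻¹)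
open import Data.Nat.Properties
  using (<ᵇ⇒<; <⇒<ᵇ; ≤ᵇ-reflects-≤; <-irrefl; <⇒≤; ≤-trans; <⇒≱; ≤-reflexive; m≤n⇒m≤1+n;
         ≤∧≢⇒<; ≰⇒>; <-cmp; suc-injective; *-monoˡ-≤; m≤n⇒m<n∨m≡n)
open import Data.Product using (_×_; _,_; proj₁; proj₂)
open import Data.Sum using (inj₁; inj₂)
open import Function using (_∘_; id; Equivalence; Injection)
open import Function.Properties.Inverse using (↔⇒↣)
open import Relation.Binary.Definitions using (tri<; tri≈; tri>)
open import Relation.Binary.PropositionalEquality
  using (_≡_; _≢_; _≗_; refl; sym; trans; cong; cong₂; subst)
open import Relation.Nullary using (yes; no; ¬_; contradiction)
open import Relation.Nullary.Reflects using (ofʸ; ofⁿ)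

private
  variable
    A B : Set

<⇒<ᵇ≡true : ∀ {m n} → m < n → (m <ᵇ n) ≡ true
<⇒<ᵇ≡true = Equivalence.to T-≡ ∘ <⇒<ᵇ

<ᵇ≡true⇒< : ∀ {m n} → (m <ᵇ n) ≡ true → m < n
<ᵇ≡true⇒< {m} {n} = <ᵇ⇒< m n ∘ Equivalence.from T-≡

≥⇒<ᵇ≡false : ∀ {m n} → n ≤ m → (m <ᵇ n) ≡ false
≥⇒<ᵇ≡false n≤m = ¬-not (λ m<ᵇn → <⇒≱ (<ᵇ≡true⇒< m<ᵇn) n≤m)

any-cong : {p q : A → Bool} → p ≗ q → any p ≗ any q
any-cong p≗q xs = cong (foldr _∨_ false) (map-cong p≗q xs)

any-false : {p : A → Bool} → (∀ x → p x ≡ false) → ∀ xs → any p xs ≡ false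
any-false p≡false []       = refl
any-false p≡false (x ∷ xs) rewrite p≡false x = any-false p≡false xs

any-tabulate-true : ∀ {j} (p : A → Bool) (g : Fin j → A) i → p (g i) ≡ true → any p (tabulate g) ≡ true
any-tabulate-true p g Fin.zero    pgi rewrite pgi = refl
any-tabulate-true p g (Fin.suc i) pgi with p (g Fin.zero)
... | true  = refl
... | false = any-tabulate-true p (g ∘ Fin.suc) i pgi

foldl-tabulate-induction : ∀ {j} (P : ℕ → A → Set) (f : A → B → A) (g : Fin j → B) {a : A} →
                           (∀ i {b} → P (toℕ i) b → P (suc (toℕ i)) (f b (g i))) →
                           P 0 a → P j (foldl f a (tabulate g))
foldl-tabulate-induction {j = zero}  P f g step p₀ = p₀
foldl-tabulate-induction {j = suc j} P f g step p₀ =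
  foldl-tabulate-induction (P ∘ suc) f (g ∘ Fin.suc) (λ i → step (Fin.suc i)) (step Fin.zero p₀)

≗⇒SameClustering : ∀ {n} {f g : Fin n → Fin n} → f ≗ g → SameClustering f g
≗⇒SameClustering f≗g u v = (λ e → trans (sym (f≗g u)) (trans e (f≗g v)))
                         , (λ e → trans (f≗g u) (trans e (sym (f≗g v))))

module _ {n : ℕ} (G : Graph n) (π : Permutation′ n) (m : ℕ) where

  rank : Fin n → ℕ
  rank = D.rank G π m

  deg : Fin n → ℕ
  deg = D.deg G π m

  byRank : List (Fin n)
  byRank = D.byRank G π m

  firstᵇ : (Fin n → Bool) → List (Fin n) → Maybe (Fin n)
  firstᵇ = D.firstᵇ G π m

  interesting : Fin n → Bool
  interesting = D.interesting G π m

  misStep : (Fin n → Bool) → Fin n → (Fin n → Bool)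
  misStep = D.misStep G π m

  pivot : Fin n → Bool
  pivot = D.pivotSet G π m

  leader : Fin n → Fin n
  leader = parLeader G π m

  rank-injective : ∀ {u v} → rank u ≡ rank v → u ≡ v
  rank-injective = Injection.injective (↔⇒↣ π) ∘ toℕ-injective ∘ suc-injective

  rank≤n : ∀ v → rank v ≤ n
  rank≤n v = toℕ<n (π ⟨$⟩ʳ v)

  rank-⟨$⟩ˡ : ∀ i → rank (π ⟨$⟩ˡ i) ≡ suc (toℕ i)
  rank-⟨$⟩ˡ i = cong (suc ∘ toℕ) (inverseʳ π)

  rank-≤-other : ∀ {k u v} → rank u ≡ suc k → v ≢ u → rank v ≤ suc k → rank v ≤ k
  rank-≤-other rank-u v≢u v≤1+k with m≤n⇒m<n∨m≡n v≤1+k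
  ... | inj₁ v<1+k = s≤s⁻¹ v<1+k
  ... | inj₂ v≡1+k = contradiction (rank-injective (trans v≡1+k (sym rank-u))) v≢u

  byRank≡tabulate : byRank ≡ tabulate (π ⟨$⟩ˡ_)
  byRank≡tabulate = map-tabulate id (π ⟨$⟩ˡ_)

  foldl-byRank-induction : (P : ℕ → A → Set) (f : A → Fin n → A) {a : A} →
                           (∀ k u {b} → rank u ≡ suc k → P k b → P (suc k) (f b u)) →
                           P 0 a → P n (foldl f a byRank)
  foldl-byRank-induction P f step p₀ =
    subst (λ xs → P n (foldl f _ xs)) (sym byRank≡tabulate)
      (foldl-tabulate-induction P f (π ⟨$⟩ˡ_) (λ i → step (toℕ i) (π ⟨$⟩ˡ i) (rank-⟨$⟩ˡ i)) p₀)

  firstᵇ-sound : ∀ p xs {w} → firstᵇ p xs ≡ just w → p w ≡ true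
  firstᵇ-sound p (x ∷ xs) e with p x in px
  firstᵇ-sound p (x ∷ xs) refl | true  = px
  firstᵇ-sound p (x ∷ xs) e    | false = firstᵇ-sound p xs e

  firstᵇ-tabulate : ∀ {j} p (g : Fin j → Fin n) i → p (g i) ≡ true →
                    (∀ i′ → p (g i′) ≡ true → toℕ i ≤ toℕ i′) → firstᵇ p (tabulate g) ≡ just (g i)
  firstᵇ-tabulate p g Fin.zero    pgi minimal rewrite pgi = refl
  firstᵇ-tabulate p g (Fin.suc i) pgi minimal with p (g Fin.zero) in pg₀
  ... | true  = contradiction (minimal Fin.zero pg₀) λ ()
  ... | false = firstᵇ-tabulate p (g ∘ Fin.suc) i pgi (λ i′ → s≤s⁻¹ ∘ minimal (Fin.suc i′))

  firstᵇ-byRank : ∀ p {u} → p u ≡ true → (∀ w → p w ≡ true → rank u ≤ rank w) → firstᵇ p byRank ≡ just u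
  firstᵇ-byRank p {u} pu minimal =
    trans (cong (firstᵇ p) byRank≡tabulate)
      (subst (λ w → firstᵇ p (tabulate (π ⟨$⟩ˡ_)) ≡ just w) (inverseˡ π)
        (firstᵇ-tabulate p (π ⟨$⟩ˡ_) (π ⟨$⟩ʳ u) (subst (λ w → p w ≡ true) (sym (inverseˡ π)) pu)
          λ i′ pi′ → s≤s⁻¹ (subst (rank u ≤_) (rank-⟨$⟩ˡ i′) (minimal _ pi′))))

  earlierNeighbourIn : (Fin n → Bool) → Fin n → Bool
  earlierNeighbourIn I v = any (λ w → I w ∧ adj G v w ∧ (rank w <ᵇ rank v)) (allFin n)

  GreedyUpTo : ℕ → (Fin n → Bool) → Set
  GreedyUpTo k I = ∀ v → (I v ≡ true → rank v ≤ k)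
                       × (rank v ≤ k → I v ≡ interesting v ∧ not (earlierNeighbourIn I v))

  misStep-other : ∀ I {u w} → w ≢ u → misStep I u w ≡ I w
  misStep-other I {u} {w} w≢u with interesting u ∧ not (any (λ x → I x ∧ adj G u x) (allFin n))
  ... | false = refl
  ... | true with w ≟ u
  ...   | yes w≡u = contradiction w≡u w≢u
  ...   | no _    = refl

  misStep-self : ∀ I u → I u ≡ false →
                 misStep I u u ≡ interesting u ∧ not (any (λ w → I w ∧ adj G u w) (allFin n))
  misStep-self I u Iu≡false with interesting u ∧ not (any (λ w → I w ∧ adj G u w) (allFin n))
  ... | false = Iu≡false
  ... | true with u ≟ u
  ...   | yes _   = refl
  ...   | no u≢u = contradiction refl u≢u

  misStep-preserves : ∀ {k I u} → rank u ≡ suc k → GreedyUpTo k I → GreedyUpTo (suc k) (misStep I u)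
  misStep-preserves {k} {I} {u} rank-u greedy v = bounded , characterised
    where
    k<u : ∀ {w} → rank w ≤ k → rank w < rank u
    k<u {w} w≤k = subst (rank w <_) (sym rank-u) (s≤s w≤k)

    Iu≡false : I u ≡ false
    Iu≡false = ¬-not (λ Iu → <-irrefl refl (k<u (proj₁ (greedy u) Iu)))

    bounded : misStep I u v ≡ true → rank v ≤ suc k
    bounded Iv with v ≟ u
    ... | yes refl = ≤-reflexive rank-u
    ... | no v≢u   = m≤n⇒m≤1+n (proj₁ (greedy v) (trans (sym (misStep-other I v≢u)) Iv))

    neighbours-of-u : ∀ w → (I w ∧ adj G u w) ≡ (misStep I u w ∧ adj G u w ∧ (rank w <ᵇ rank u))
    neighbours-of-u w with w ≟ u
    ... | yes refl rewrite Graph.irrefl G w = trans (∧-zeroʳ (I w)) (sym (∧-zeroʳ (misStep I w w)))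
    ... | no w≢u rewrite misStep-other I w≢u with I w in Iw
    ...   | false = refl
    ...   | true rewrite <⇒<ᵇ≡true (k<u (proj₁ (greedy w) Iw)) = sym (∧-identityʳ _)

    earlier-neighbours : rank v ≤ k → earlierNeighbourIn I v ≡ earlierNeighbourIn (misStep I u) v
    earlier-neighbours v≤k = any-cong same (allFin n)
      where
      same : ∀ w → (I w ∧ adj G v w ∧ (rank w <ᵇ rank v)) ≡ (misStep I u w ∧ adj G v w ∧ (rank w <ᵇ rank v))
      same w with w ≟ u
      ... | yes refl rewrite ≥⇒<ᵇ≡false (<⇒≤ (k<u v≤k)) | ∧-zeroʳ (adj G v w)
                           | ∧-zeroʳ (I w) | ∧-zeroʳ (misStep I w w) = refl
      ... | no w≢u rewrite misStep-other I w≢u = refl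

    characterised : rank v ≤ suc k → misStep I u v ≡ interesting v ∧ not (earlierNeighbourIn (misStep I u) v)
    characterised v≤1+k with v ≟ u
    ... | yes refl = trans (misStep-self I v Iu≡false)
                           (cong (λ b → interesting v ∧ not b) (any-cong neighbours-of-u (allFin n)))
    ... | no v≢u   = trans (misStep-other I v≢u) (trans (proj₂ (greedy v) v≤k)
                           (cong (λ b → interesting v ∧ not b) (earlier-neighbours v≤k)))
      where
      v≤k : rank v ≤ k
      v≤k = rank-≤-other rank-u v≢u v≤1+k

  pivot-spec : ∀ v → pivot v ≡ interesting v ∧ not (earlierNeighbourIn pivot v)
  pivot-spec v = proj₂ (foldl-byRank-induction GreedyUpTo misStep (λ _ _ → misStep-preserves) nothing-yet v) (rank≤n v)
    where
    nothing-yet : GreedyUpTo 0 (λ _ → false)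
    nothing-yet _ = (λ ()) , (λ ())

  pivot⇒interesting : ∀ {v} → pivot v ≡ true → rank v * deg v < m
  pivot⇒interesting {v} pv = <ᵇ≡true⇒< (∧-conicalˡ _ _ (trans (sym (pivot-spec v)) pv))

  pivot-intro : ∀ {v} → rank v * deg v < m → (∀ w → rank w < rank v → pivot w ≡ true → adj G v w ≡ false) →
                pivot v ≡ true
  pivot-intro {v} interesting-v no-earlier-pivot =
    trans (pivot-spec v) (cong₂ (λ a b → a ∧ not b) (<⇒<ᵇ≡true interesting-v) (any-false none (allFin n)))
    where
    none : ∀ w → (pivot w ∧ adj G v w ∧ (rank w <ᵇ rank v)) ≡ false
    none w with pivot w in pw | adj G v w in vw | rank w <ᵇ rank v in w<ᵇv
    ... | false | _     | _     = refl
    ... | true  | false | _     = refl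
    ... | true  | true  | false = refl
    ... | true  | true  | true  = contradiction (trans (sym vw) (no-earlier-pivot w (<ᵇ≡true⇒< w<ᵇv) pw)) λ ()

  pivot-earlier-free : ∀ {v w} → pivot v ≡ true → pivot w ≡ true → adj G v w ≡ true → ¬ rank w < rank v
  pivot-earlier-free {v} {w} pv pw vw w<v = contradiction (subst (λ b → not b ≡ true) earlier no-earlier) λ ()
    where
    no-earlier : not (earlierNeighbourIn pivot v) ≡ true
    no-earlier = ∧-conicalʳ _ _ (trans (sym (pivot-spec v)) pv)
    earlier : earlierNeighbourIn pivot v ≡ true
    earlier = any-tabulate-true _ id w
                (trans (cong₂ (λ a b → a ∧ b ∧ (rank w <ᵇ rank v)) pw vw) (<⇒<ᵇ≡true w<v))

  pivot-neighbour-not-pivot : ∀ {u v} → pivot u ≡ true → adj G v u ≡ true → pivot v ≡ false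
  pivot-neighbour-not-pivot {u} {v} pu vu with <-cmp (rank u) (rank v)
  ... | tri< u<v _ _ = ¬-not λ pv → pivot-earlier-free pv pu vu u<v
  ... | tri> _ _ v<u = ¬-not λ pv → pivot-earlier-free pu pv (trans (Graph.sym G u v) vu) v<u
  ... | tri≈ _ u≡v _ with rank-injective u≡v
  ...   | refl = contradiction (trans (sym vu) (Graph.irrefl G u)) λ ()

  leader-pivot : ∀ {v} → pivot v ≡ true → leader v ≡ v
  leader-pivot pv rewrite pv = refl

  leader-unclustered : ∀ {v} → pivot v ≡ false →
                       (∀ w → pivot w ≡ true → adj G v w ≡ true → m ≤ rank w * deg v) → leader v ≡ v
  leader-unclustered {v} pv far rewrite pv with firstᵇ (λ w → pivot w ∧ adj G v w) byRank in first
  ... | nothing = refl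
  ... | just w with firstᵇ-sound _ byRank first
  ...   | found rewrite ≥⇒<ᵇ≡false (far w (∧-conicalˡ _ _ found) (∧-conicalʳ _ _ found)) = refl

  leader-joins : ∀ {u v} → pivot v ≡ false → pivot u ≡ true → adj G v u ≡ true →
                 (∀ w → pivot w ≡ true → adj G v w ≡ true → rank u ≤ rank w) → rank u * deg v < m →
                 leader v ≡ u
  leader-joins {u} {v} pv pu vu nearest near
    with firstᵇ-byRank (λ w → pivot w ∧ adj G v w) (cong₂ _∧_ pu vu)
           (λ w found → nearest w (∧-conicalˡ _ _ found) (∧-conicalʳ _ _ found))
  ... | first rewrite pv | first | <⇒<ᵇ≡true near = refl

  State : Set
  State = D.State G π m

  seqStep : State → Fin n → State
  seqStep = D.seqStep G π m

  truncate : State → Fin n → State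
  truncate s u v = if is-nothing (s v) ∧ (m ≤ᵇ rank u * deg v) then just v else s v

  Agrees : ℕ → Fin n → Maybe (Fin n) → Set
  Agrees k v nothing  = k < rank v × (∀ w → rank w ≤ k → pivot w ≡ true → adj G v w ≡ false)
  Agrees k v (just l) = l ≡ leader v × (pivot v ≡ true → rank v ≤ k)

  Invariant : ℕ → State → Set
  Invariant k s = ∀ v → Agrees k v (s v)

  module SeqStep {k : ℕ} {u : Fin n} (rank-u : rank u ≡ suc k) where

    later-pivot-neighbours : ∀ {v w} → Agrees k v nothing → pivot w ≡ true → adj G v w ≡ true → rank u ≤ rank w
    later-pivot-neighbours {w = w} (_ , no-earlier) pw vw =
      subst (_≤ rank w) (sym rank-u) (≰⇒> λ w≤k → contradiction (trans (sym vw) (no-earlier w w≤k pw)) λ ())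

    active-pivot : Agrees k u nothing → rank u * deg u < m → pivot u ≡ true
    active-pivot (_ , no-earlier) interesting-u =
      pivot-intro interesting-u λ w w<u → no-earlier w (s≤s⁻¹ (subst (rank w <_) rank-u w<u))

    pivot-agrees : pivot u ≡ true → Agrees (suc k) u (just u)
    pivot-agrees pu = sym (leader-pivot pu) , λ _ → ≤-reflexive rank-u

    stays-active : ∀ {v} → Agrees k v nothing → v ≢ u → (pivot u ≡ true → adj G v u ≡ false) →
                   Agrees (suc k) v nothing
    stays-active {v} (k<v , no-earlier) v≢u not-adjacent = k+1<v , no-earlier′
      where
      k+1<v : suc k < rank v
      k+1<v = ≤∧≢⇒< k<v λ k+1≡v → v≢u (rank-injective (trans (sym k+1≡v) (sym rank-u)))
      no-earlier′ : ∀ w → rank w ≤ suc k → pivot w ≡ true → adj G v w ≡ false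
      no-earlier′ w w≤k+1 pw with w ≟ u
      ... | yes refl = not-adjacent pw
      ... | no w≢u   = no-earlier w (rank-≤-other rank-u w≢u w≤k+1) pw

    truncated-agrees : ∀ {v} → Agrees k v nothing → m ≤ rank u * deg v → Agrees (suc k) v (just v)
    truncated-agrees {v} active truncated =
      sym (leader-unclustered not-pivot far) , λ pv → contradiction (trans (sym pv) not-pivot) λ ()
      where
      far : ∀ w → pivot w ≡ true → adj G v w ≡ true → m ≤ rank w * deg v
      far w pw vw = ≤-trans truncated (*-monoˡ-≤ (deg v) (later-pivot-neighbours active pw vw))
      not-pivot : pivot v ≡ false
      not-pivot = ¬-not λ pv → <⇒≱ (pivot⇒interesting pv)
                    (≤-trans truncated (*-monoˡ-≤ (deg v) (subst (_≤ rank v) (sym rank-u) (proj₁ active))))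

    joins-agrees : ∀ {v} → Agrees k v nothing → rank u * deg v < m → pivot u ≡ true → adj G v u ≡ true →
                   Agrees (suc k) v (just u)
    joins-agrees {v} active near pu vu =
        sym (leader-joins not-pivot pu vu (λ _ → later-pivot-neighbours active) near)
      , λ pv → contradiction (trans (sym pv) not-pivot) λ ()
      where
      not-pivot : pivot v ≡ false
      not-pivot = pivot-neighbour-not-pivot pu vu

    pivot-iff-active : ∀ {s} → Invariant k s → pivot u ≡ is-nothing (truncate s u u)
    pivot-iff-active {s} inv with s u | inv u
    ... | just _  | (_ , pu⇒u≤k) = ¬-not λ pu → <⇒≱ (≤-reflexive (sym rank-u)) (pu⇒u≤k pu)
    ... | nothing | active with m ≤ᵇ rank u * deg u | ≤ᵇ-reflects-≤ m (rank u * deg u)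
    ...   | true  | ofʸ truncated = ¬-not λ pu → <⇒≱ (pivot⇒interesting pu) truncated
    ...   | false | ofⁿ spared    = active-pivot active (≰⇒> spared)

    seqStep-by-pivot : ∀ {s} → Invariant k s → ∀ v →
      seqStep s u v ≡ (if pivot u
                       then (if is-nothing (truncate s u v) ∧ (D.eqᵇ G π m v u ∨ adj G u v) then just u
                             else truncate s u v)
                       else truncate s u v)
    seqStep-by-pivot {s} inv v rewrite pivot-iff-active inv =
      if-float (λ (t : State) → t v) (is-nothing (truncate s u u)) {y = truncate s u}

    step-preserves : ∀ {s} → Invariant k s → Invariant (suc k) (seqStep s u)
    step-preserves {s} inv v rewrite seqStep-by-pivot inv v with s v | inv v
    ... | just l  | (l≡leader , pv⇒v≤k) with pivot u
    ...   | true  = l≡leader , m≤n⇒m≤1+n ∘ pv⇒v≤k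
    ...   | false = l≡leader , m≤n⇒m≤1+n ∘ pv⇒v≤k
    step-preserves {s} inv v | nothing | active with m ≤ᵇ rank u * deg v | ≤ᵇ-reflects-≤ m (rank u * deg v)
    ...   | true  | ofʸ truncated with pivot u
    ...     | true  = truncated-agrees active truncated
    ...     | false = truncated-agrees active truncated
    step-preserves {s} inv v | nothing | active | false | ofⁿ spared with pivot u in pu
    ...     | false = stays-active active v≢u λ pu′ → contradiction (trans (sym pu′) pu) λ ()
      where
      v≢u : v ≢ u
      v≢u refl = contradiction (trans (sym (active-pivot active (≰⇒> spared))) pu) λ ()
    ...     | true with v ≟ u | adj G u v in uv
    ...       | yes refl | _     = pivot-agrees pu
    ...       | no v≢u   | true  = joins-agrees active (≰⇒> spared) pu (trans (Graph.sym G v u) uv)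
    ...       | no v≢u   | false = stays-active active v≢u λ _ → trans (Graph.sym G v u) uv

  seqFinal-agrees : Invariant n (D.seqFinal G π m)
  seqFinal-agrees = foldl-byRank-induction Invariant seqStep (λ _ _ rank-u → SeqStep.step-preserves rank-u) all-active
    where
    all-active : Invariant 0 (λ _ → nothing)
    all-active _ = z<s , λ _ ()

  seqLeader≗leader : seqLeader G π m ≗ leader
  seqLeader≗leader v with D.seqFinal G π m v | seqFinal-agrees v
  ... | nothing | (n<v , _)       = contradiction (rank≤n v) (<⇒≱ n<v)
  ... | just l  | (l≡leader , _)  = l≡leader

lemma8 : ∀ {n : ℕ} (G : Graph n) (π : Permutation′ n) (m : ℕ) →
         SameClustering (seqLeader G π m) (parLeader G π m)
lemma8 G π m = ≗⇒SameClustering (seqLeader≗leader G π m)
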